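{- For integers $0\le k\le n$ and $0\le m\le\min(k,n-k)$, \[P(n,k,m)\le2^{n-2}\left(\left(k-\frac m2\right)^2+k+\frac{7m}{4}+8\right)+2^k\left(\frac32\right)^m\left(\frac k2-\frac m6\right)-2^k(k+1)-2^{n-k}\left(\frac32\right)^m,\] where $P(n,k,m)=\sum_{i=0}^{m-1}\sum_{j=0}^{i}\binom ij\left((k-j)2^{k-j-1}+2^{n-i-1}\right)+\sum_{i=0}^{m}\binom miP(n-m,k-i)$.
   Context: For a power of two $M$ let $O(M)=\frac M4(\log_2^2M-\log_2M+4)-1$. For powers of two $1\le K\le N$ define $H(N,K)$ (the number of comparators of the improved pairwise selection network $pw\_hbit\_sel^N_K$) by $H(N,1)=N-1$; $H(N,N)=O(N)$ for $N>1$; $H(N,K)=H(N/2,K)+H(N/2,K/2)+\frac N2+\frac{K\log_2K}{2}$ for $1<K<N$. Set $P(n,k)=H(2^n,2^k)$ for integers $0\le k\le n$. -}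

module Defs where

open import Data.Nat as ℕ using (ℕ; zero; suc; _+_; _*_; _∸_; _^_; _≟_)
open import Data.Nat.DivMod using (_/_)
open import Data.Nat.Combinatorics using (_C_)
open import Data.List using (List; map; upTo)
open import Data.Nat.ListAction using (sum)
open import Data.Integer using (+_)
open import Data.Rational as ℚ using (ℚ)
open import Relation.Nullary using (yes; no)

-- O(2^n) = 2^n/4 (n^2 - n + 4) - 1   (the division by 4 is exact for n ≥ 1)
O : ℕ → ℕ
O n = (2 ^ n * (n * n ∸ n + 4)) / 4 ∸ 1

-- P n k = H(2^n, 2^k) for 0 ≤ k ≤ n (values for k > n are junk and never used).
-- H(N,1) = N-1 ; H(N,N) = O(N) for N>1 ;
-- H(N,K) = H(N/2,K) + H(N/2,K/2) + N/2 + K log2 K / 2   for 1<K<N,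
-- where with N = 2^(n+1), K = 2^(k+1):  N/2 = 2^n,  K log2 K / 2 = (k+1) 2^k.
P : ℕ → ℕ → ℕ
P n zero = 2 ^ n ∸ 1
P zero (suc k) = 0
P (suc n) (suc k) with k ≟ n
... | yes _ = O (suc n)
... | no  _ = P n (suc k) + P n k + 2 ^ n + suc k * 2 ^ k

Σ< : ℕ → (ℕ → ℕ) → ℕ
Σ< m f = sum (map f (upTo m))

P3 : ℕ → ℕ → ℕ → ℕ
P3 n k m =
  Σ< m (λ i → Σ< (suc i) (λ j →
      (i C j) * ((k ∸ j) * 2 ^ (k ∸ j ∸ 1) + 2 ^ (n ∸ i ∸ 1))))
  + Σ< (suc m) (λ i → (m C i) * P (n ∸ m) (k ∸ i))

ℕ→ℚ : ℕ → ℚ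
ℕ→ℚ n = (+ n) ℚ./ 1

_^ℚ_ : ℚ → ℕ → ℚ
q ^ℚ zero = ℚ.1ℚ
q ^ℚ suc m = q ℚ.* (q ^ℚ m)

RHS : ℕ → ℕ → ℕ → ℚ
RHS n k m =
    ((+ (2 ^ n)) ℚ./ 4) ℚ.*
      ((kq ℚ.- mq ℚ.* ℚ.½) ℚ.* (kq ℚ.- mq ℚ.* ℚ.½)
        ℚ.+ kq ℚ.+ ((+ 7) ℚ./ 4) ℚ.* mq ℚ.+ ℕ→ℚ 8)
  ℚ.+ ℕ→ℚ (2 ^ k) ℚ.* (t ^ℚ m) ℚ.* (kq ℚ.* ℚ.½ ℚ.- mq ℚ.* ((+ 1) ℚ./ 6))
  ℚ.- ℕ→ℚ (2 ^ k) ℚ.* ℕ→ℚ (k + 1)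
  ℚ.- ℕ→ℚ (2 ^ (n ∸ k)) ℚ.* (t ^ℚ m)
  where
    kq = ℕ→ℚ k
    mq = ℕ→ℚ m
    t = (+ 3) ℚ./ 2

-- P3 n k m is P n k with its recursion P(n+1,k+1) = P(n,k+1) + P(n,k) + (k+1)2^k + 2^n unrolled
-- m times (the binomial coefficients come from Pascal's rule), so it suffices to bound P n k.
-- Writing n = k + d, the right-hand side satisfies the same recursion in (k, d) exactly, provided m
-- drops by one as well; so induction on m reduces the bound to m = 0. There the recursion only holds
-- up to a nonnegative slack, and the boundary values P(d,0) = 2^d - 1 and P(k,k) = O(2^k) meet the
-- bound; this case is proved in ℕ after multiplying by 4.
module Submission where

open import Defs
open import Data.Nat using (ℕ; _≤_; _⊓_; _∸_)
open import Data.Rational using (ℚ) renaming (_≤_ to _≤ℚ_)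
open import Algebra.Bundles.Raw using (RawRing)
open import Level using (0ℓ)

module Recurrence where
  open import Data.Nat using (ℕ; zero; suc; _+_; _*_; _∸_; _^_; _≤_; _<_; _≟_; s≤s; z<s)
  open import Data.Nat.Properties
  open import Data.Nat.Combinatorics using (_C_; nCk+nC[k+1]≡[n+1]C[k+1]; k>n⇒nCk≡0)
  open import Data.Nat.ListAction using (sum)
  open import Data.Nat.ListAction.Properties using (sum-++)
  open import Data.List using (map; upTo; applyUpTo; [_]; _++_)
  open import Data.List.Properties using (map-upTo; upTo-∷ʳ; map-++; map-cong-local)
  open import Data.List.Relation.Unary.All.Properties using (applyUpTo⁺₁)
  open import Algebra.Properties.CommutativeSemigroup +-commutativeSemigroup using (interchange)
  open import Function using (_∘_)
  open import Relation.Nullary using (yes; no; contradiction)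
  open import Relation.Binary.PropositionalEquality using (_≡_; refl; sym; trans; cong; cong₂; subst; module ≡-Reasoning)
  open ≡-Reasoning

  P-suc-suc : ∀ {n k} → k < n → P (suc n) (suc k) ≡ P n (suc k) + P n k + (suc k * 2 ^ k + 2 ^ n)
  P-suc-suc {n} {k} k<n with k ≟ n
  ... | yes k≡n = contradiction k≡n (<⇒≢ k<n)
  ... | no  _   = trans (+-assoc (P n (suc k) + P n k) (2 ^ n) (suc k * 2 ^ k))
                        (cong (P n (suc k) + P n k +_) (+-comm (2 ^ n) (suc k * 2 ^ k)))

  P-pred : ∀ {n k} → 0 < k → k < n → P n k ≡ P (n ∸ 1) k + P (n ∸ 1) (k ∸ 1) + (k * 2 ^ (k ∸ 1) + 2 ^ (n ∸ 1))
  P-pred {suc n} {suc k} _ (s≤s k<n) = P-suc-suc k<n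

  P-split : ∀ k d → P (suc k + suc d) (suc k) ≡ P (suc k + d) (suc k) + P (k + suc d) k + (suc k * 2 ^ k + 2 ^ k * 2 ^ suc d)
  P-split k d = trans (P-suc-suc (m<m+n k z<s))
    (cong₂ (λ n e → P n (suc k) + P (k + suc d) k + (suc k * 2 ^ k + e)) (+-suc k d) (^-distribˡ-+-* 2 k (suc d)))

  P-diag : ∀ k → P (suc k) (suc k) ≡ O (suc k)
  P-diag k with k ≟ k
  ... | yes _   = refl
  ... | no  k≢k = contradiction refl k≢k

  m∸n∸1≡m∸[1+n] : ∀ m n → m ∸ n ∸ 1 ≡ m ∸ suc n
  m∸n∸1≡m∸[1+n] m n = trans (∸-+-assoc m n 1) (cong (m ∸_) (+-comm n 1))

  Σ<-suc : ∀ m f → Σ< (suc m) f ≡ f 0 + Σ< m (λ i → f (suc i))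
  Σ<-suc m f = begin
    Σ< (suc m) f                              ≡⟨ cong sum (map-upTo f (suc m)) ⟩
    f 0 + sum (applyUpTo (λ i → f (suc i)) m) ≡⟨ cong (λ xs → f 0 + sum xs) (map-upTo (λ i → f (suc i)) m) ⟨
    f 0 + Σ< m (λ i → f (suc i))              ∎

  Σ<-last : ∀ m f → Σ< (suc m) f ≡ Σ< m f + f m
  Σ<-last m f = begin
    Σ< (suc m) f                    ≡⟨ cong (sum ∘ map f) (upTo-∷ʳ m) ⟨
    sum (map f (upTo m ++ [ m ]))   ≡⟨ cong sum (map-++ f (upTo m) [ m ]) ⟩
    sum (map f (upTo m) ++ [ f m ]) ≡⟨ sum-++ (map f (upTo m)) [ f m ] ⟩
    Σ< m f + (f m + 0)              ≡⟨ cong (Σ< m f +_) (+-identityʳ (f m)) ⟩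
    Σ< m f + f m                    ∎

  Σ<-cong : ∀ m {f g : ℕ → ℕ} → (∀ {i} → i < m → f i ≡ g i) → Σ< m f ≡ Σ< m g
  Σ<-cong m f≗g = cong sum (map-cong-local (applyUpTo⁺₁ (λ i → i) m f≗g))

  Σ<-+ : ∀ m (f g : ℕ → ℕ) → Σ< m (λ i → f i + g i) ≡ Σ< m f + Σ< m g
  Σ<-+ zero    f g = refl
  Σ<-+ (suc m) f g = begin
    Σ< (suc m) (λ i → f i + g i)                    ≡⟨ Σ<-suc m _ ⟩
    f 0 + g 0 + Σ< m (λ i → f (suc i) + g (suc i))  ≡⟨ cong (f 0 + g 0 +_) (Σ<-+ m (f ∘ suc) (g ∘ suc)) ⟩
    f 0 + g 0 + (Σ< m (f ∘ suc) + Σ< m (g ∘ suc))   ≡⟨ interchange (f 0) (g 0) _ _ ⟩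
    (f 0 + Σ< m (f ∘ suc)) + (g 0 + Σ< m (g ∘ suc)) ≡⟨ cong₂ _+_ (Σ<-suc m f) (Σ<-suc m g) ⟨
    Σ< (suc m) f + Σ< (suc m) g                     ∎

  Σ<-pascal : ∀ m (g : ℕ → ℕ) →
    Σ< (suc (suc m)) (λ i → (suc m C i) * g i) ≡ Σ< (suc m) (λ i → (m C i) * (g i + g (suc i)))
  Σ<-pascal m g = begin
    Σ< (suc (suc m)) (λ i → (suc m C i) * g i)       ≡⟨ Σ<-suc (suc m) (λ i → (suc m C i) * g i) ⟩
    g₀ + Σ< (suc m) (λ i → (suc m C suc i) * g (suc i)) ≡⟨ cong (g₀ +_) (Σ<-cong (suc m) λ {i} _ → pascal-row i) ⟩
    g₀ + Σ< (suc m) (λ i → a i + b i)                 ≡⟨ cong (g₀ +_) (Σ<-+ (suc m) a b) ⟩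
    g₀ + (Σ< (suc m) a + Σ< (suc m) b)                ≡⟨ cong (λ x → g₀ + (Σ< (suc m) a + x)) drop-last ⟩
    g₀ + (Σ< (suc m) a + Σ< m b)                      ≡⟨ cong (g₀ +_) (+-comm (Σ< (suc m) a) (Σ< m b)) ⟩
    g₀ + (Σ< m b + Σ< (suc m) a)                      ≡⟨ +-assoc g₀ (Σ< m b) (Σ< (suc m) a) ⟨
    g₀ + Σ< m b + Σ< (suc m) a                        ≡⟨ cong (_+ Σ< (suc m) a) (Σ<-suc m (λ i → (m C i) * g i)) ⟨
    Σ< (suc m) (λ i → (m C i) * g i) + Σ< (suc m) a   ≡⟨ Σ<-+ (suc m) (λ i → (m C i) * g i) a ⟨
    Σ< (suc m) (λ i → (m C i) * g i + a i)            ≡⟨ Σ<-cong (suc m) (λ {i} _ → *-distribˡ-+ (m C i) (g i) (g (suc i))) ⟨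
    Σ< (suc m) (λ i → (m C i) * (g i + g (suc i)))    ∎
    where
    g₀ = 1 * g 0
    a b : ℕ → ℕ
    a i = (m C i) * g (suc i)
    b i = (m C suc i) * g (suc i)
    pascal-row : ∀ i → (suc m C suc i) * g (suc i) ≡ a i + b i
    pascal-row i = trans (cong (_* g (suc i)) (sym (nCk+nC[k+1]≡[n+1]C[k+1] m i)))
                         (*-distribʳ-+ (g (suc i)) (m C i) (m C suc i))
    drop-last : Σ< (suc m) b ≡ Σ< m b
    drop-last = begin
      Σ< (suc m) b                  ≡⟨ Σ<-last m b ⟩
      Σ< m b + (m C suc m) * g (suc m) ≡⟨ cong (λ c → Σ< m b + c * g (suc m)) (k>n⇒nCk≡0 (n<1+n m)) ⟩
      Σ< m b + 0                    ≡⟨ +-identityʳ (Σ< m b) ⟩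
      Σ< m b                        ∎

  P3-unroll : ∀ {n k m} → m < k → k + suc m ≤ n → P3 n k (suc m) ≡ P3 n k m
  P3-unroll {n} {k} {m} m<k k+m<n = begin
    P3 n k (suc m)                                          ≡⟨ cong₂ _+_ (Σ<-last m F) (Σ<-pascal m g) ⟩
    Σ< m F + F m + Σ< (suc m) u                             ≡⟨ +-assoc (Σ< m F) (F m) (Σ< (suc m) u) ⟩
    Σ< m F + (Σ< (suc m) v + Σ< (suc m) u)                  ≡⟨ cong (Σ< m F +_) (+-comm (F m) (Σ< (suc m) u)) ⟩
    Σ< m F + (Σ< (suc m) u + Σ< (suc m) v)                  ≡⟨ cong (Σ< m F +_) (Σ<-+ (suc m) u v) ⟨
    Σ< m F + Σ< (suc m) (λ i → u i + v i)                   ≡⟨ cong (Σ< m F +_) (Σ<-cong (suc m) merge) ⟩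
    Σ< m F + Σ< (suc m) (λ i → (m C i) * P (n ∸ m) (k ∸ i)) ≡⟨⟩
    P3 n k m                                                ∎
    where
    r : ℕ → ℕ → ℕ
    r i j = (k ∸ j) * 2 ^ (k ∸ j ∸ 1) + 2 ^ (n ∸ i ∸ 1)
    F : ℕ → ℕ
    F i = Σ< (suc i) (λ j → (i C j) * r i j)
    g : ℕ → ℕ
    g i = P (n ∸ suc m) (k ∸ i)
    u v : ℕ → ℕ
    u i = (m C i) * (g i + g (suc i))
    v i = (m C i) * r m i
    k<n∸m : k < n ∸ m
    k<n∸m = m+n≤o⇒m≤o∸n (suc k) (subst (_≤ n) (+-suc k m) k+m<n)
    P-unrolled : ∀ {i} → i < suc m → P (n ∸ m) (k ∸ i) ≡ g i + g (suc i) + r m i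
    P-unrolled {i} i≤m = begin
      P (n ∸ m) (k ∸ i)
        ≡⟨ P-pred (m<n⇒0<n∸m (<-≤-trans i≤m m<k)) (≤-<-trans (m∸n≤m k i) k<n∸m) ⟩
      P (n ∸ m ∸ 1) (k ∸ i) + P (n ∸ m ∸ 1) (k ∸ i ∸ 1) + r m i
        ≡⟨ cong₂ (λ a b → P a (k ∸ i) + P a b + r m i) (m∸n∸1≡m∸[1+n] n m) (m∸n∸1≡m∸[1+n] k i) ⟩
      g i + g (suc i) + r m i
        ∎
    merge : ∀ {i} → i < suc m → u i + v i ≡ (m C i) * P (n ∸ m) (k ∸ i)
    merge {i} i≤m = trans (sym (*-distribˡ-+ (m C i) _ _)) (cong ((m C i) *_) (sym (P-unrolled i≤m)))

  P3≡P : ∀ {n k} m → m ≤ k → k + m ≤ n → P3 n k m ≡ P n k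
  P3≡P {n} {k} zero    _   _     = trans (+-identityʳ (1 * P n k)) (*-identityˡ (P n k))
  P3≡P         (suc m) m<k k+m≤n =
    trans (P3-unroll m<k k+m≤n) (P3≡P m (<⇒≤ m<k) (≤-trans (+-monoʳ-≤ _ (n≤1+n m)) k+m≤n))

module BaseCase where
  open Recurrence using (P-split; P-diag)
  open import Data.Nat using (ℕ; zero; suc; _+_; _*_; _∸_; _^_; _≤_; _<_; NonZero)
  open import Data.Nat.Properties
  open import Data.Nat.DivMod using (_/_; m/n*n≤m)
  open import Data.Nat.Tactic.RingSolver using (solve-∀)
  open import Relation.Binary.PropositionalEquality using (_≡_; sym; trans; cong; subst)

  m*[n/m∸1]+m≤n : ∀ m n .{{_ : NonZero m}} → m ≤ n → m * (n / m ∸ 1) + m ≤ n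
  m*[n/m∸1]+m≤n m n m≤n with n / m | m/n*n≤m n m
  ... | zero  | _       = subst (_≤ n) (cong (_+ m) (sym (*-zeroʳ m))) m≤n
  ... | suc q | [q+1]m≤n = subst (_≤ n) (trans (+-comm m (q * m)) (cong (_+ m) (*-comm q m))) [q+1]m≤n

  -- 4 · RHS (k + d) k 0 = rhs₀⁺ k d - rhs₀⁻ k d
  rhs₀⁺ rhs₀⁻ : ℕ → ℕ → ℕ
  rhs₀⁺ k d = 2 ^ k * 2 ^ d * (k * k + k + 8)
  rhs₀⁻ k d = 2 * (k + 2) * 2 ^ k + 4 * 2 ^ d

  4*O[1+k]+4≤2^[1+k]*[k*[1+k]+4] : ∀ k → 4 * O (suc k) + 4 ≤ 2 ^ suc k * (k * suc k + 4)
  4*O[1+k]+4≤2^[1+k]*[k*[1+k]+4] k =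
    subst (λ s → 4 * O (suc k) + 4 ≤ 2 ^ suc k * (s + 4))
          (m+n∸m≡n (suc k) (k * suc k))
          (m*[n/m∸1]+m≤n 4 _ (≤-trans (m≤n+m 4 _) (m≤n*m _ (2 ^ suc k) {{m^n≢0 2 (suc k)}})))

  P-bound₀-diag : ∀ k → 4 * P (suc k) (suc k) + rhs₀⁻ (suc k) 0 ≤ rhs₀⁺ (suc k) 0
  P-bound₀-diag k = begin
    4 * P (suc k) (suc k) + rhs₀⁻ (suc k) 0       ≡⟨ cong (λ p → 4 * p + rhs₀⁻ (suc k) 0) (P-diag k) ⟩
    4 * O (suc k) + (2 * (suc k + 2) * Y + 4 * 1) ≡⟨ shuffle (4 * O (suc k)) (2 * (suc k + 2) * Y) ⟩
    4 * O (suc k) + 4 + 2 * (suc k + 2) * Y       ≤⟨ +-monoˡ-≤ _ (4*O[1+k]+4≤2^[1+k]*[k*[1+k]+4] k) ⟩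
    Y * (k * suc k + 4) + 2 * (suc k + 2) * Y     ≡⟨ collect k Y ⟩
    rhs₀⁺ (suc k) 0                               ∎
    where
    open ≤-Reasoning
    Y = 2 ^ suc k
    shuffle : ∀ x y → x + (y + 4 * 1) ≡ x + 4 + y
    shuffle = solve-∀
    collect : ∀ k Y → Y * (k * (1 + k) + 4) + 2 * (1 + k + 2) * Y ≡ Y * 1 * ((1 + k) * (1 + k) + (1 + k) + 8)
    collect = solve-∀

  -- Deliberately not proved by matching on the equation: type checking the clauses below would
  -- then normalise the ring-solver proofs passed to it, which is very slow.
  m+o≡n⇒m≤n : ∀ {m n} o → m + o ≡ n → m ≤ n
  m+o≡n⇒m≤n {m} o eq = ≤-trans (m≤m+n m o) (≤-reflexive eq)

  k*2^k+4*2^k*Z≤2*[k+1]*2^k*Z+2*Z : ∀ k {Z} → 0 < Z → k * 2 ^ k + 4 * 2 ^ k * Z ≤ 2 * (k + 1) * 2 ^ k * Z + 2 * Z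
  k*2^k+4*2^k*Z≤2*[k+1]*2^k*Z+2*Z zero          {Z}     _ = ≤-reflexive (k≡0 Z)
    where
    k≡0 : ∀ Z → 0 * 1 + 4 * 1 * Z ≡ 2 * (0 + 1) * 1 * Z + 2 * Z
    k≡0 = solve-∀
  k*2^k+4*2^k*Z≤2*[k+1]*2^k*Z+2*Z (suc zero)    {suc z} _ = m+o≡n⇒m≤n (2 * z) (k≡1 z)
    where
    k≡1 : ∀ z → 1 * 2 + 4 * 2 * (1 + z) + 2 * z ≡ 2 * (1 + 1) * 2 * (1 + z) + 2 * (1 + z)
    k≡1 = solve-∀
  k*2^k+4*2^k*Z≤2*[k+1]*2^k*Z+2*Z (suc (suc j)) {suc z} _ = m+o≡n⇒m≤n _ (k≡2+j j (2 ^ (2 + j)) z)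
    where
    k≡2+j : ∀ j X z → (2 + j) * X + 4 * X * (1 + z) + (j * X + 2 * X * z * (j + 1) + 2 + 2 * z)
                      ≡ 2 * (2 + j + 1) * X * (1 + z) + 2 * (1 + z)
    k≡2+j = solve-∀

  rhs₀-gap : ∀ k d →
    rhs₀⁺ (suc k) d + rhs₀⁺ k (suc d) + 4 * (suc k * 2 ^ k + 2 ^ k * 2 ^ suc d) + rhs₀⁻ (suc k) (suc d)
      ≤ rhs₀⁺ (suc k) (suc d) + (rhs₀⁻ (suc k) d + rhs₀⁻ k (suc d))
  rhs₀-gap k d = +-cancelʳ-≤ (2 * surplus) _ _ (begin
    rhs₀⁺ (suc k) d + rhs₀⁺ k (suc d) + 4 * (suc k * X + X * (2 * Z)) + rhs₀⁻ (suc k) (suc d) + 2 * surplus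
      ≡⟨ gap-identity k X Z ⟩
    R + 2 * deficit
      ≤⟨ +-monoʳ-≤ R (*-monoʳ-≤ 2 (k*2^k+4*2^k*Z≤2*[k+1]*2^k*Z+2*Z k (m^n>0 2 d))) ⟩
    R + 2 * surplus ∎)
    where
    open ≤-Reasoning
    X = 2 ^ k
    Z = 2 ^ d
    R = rhs₀⁺ (suc k) (suc d) + (rhs₀⁻ (suc k) d + rhs₀⁻ k (suc d))
    surplus = 2 * (k + 1) * X * Z + 2 * Z
    deficit = k * X + 4 * X * Z
    gap-identity : ∀ k X Z →
      2 * X * Z * ((1 + k) * (1 + k) + (1 + k) + 8) + X * (2 * Z) * (k * k + k + 8)
        + 4 * ((1 + k) * X + X * (2 * Z)) + (2 * (1 + k + 2) * (2 * X) + 4 * (2 * Z))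
        + 2 * (2 * (k + 1) * X * Z + 2 * Z)
      ≡ 2 * X * (2 * Z) * ((1 + k) * (1 + k) + (1 + k) + 8)
        + ((2 * (1 + k + 2) * (2 * X) + 4 * Z) + (2 * (k + 2) * X + 4 * (2 * Z)))
        + 2 * (k * X + 4 * X * Z)
    gap-identity = solve-∀

  scaled-sum-bound : ∀ {c x₁ x₂ e a₁ a₂ b₁ b₂ a b} → c * x₁ + b₁ ≤ a₁ → c * x₂ + b₂ ≤ a₂ →
    a₁ + a₂ + c * e + b ≤ a + (b₁ + b₂) → c * (x₁ + x₂ + e) + b ≤ a
  scaled-sum-bound {c} {x₁} {x₂} {e} {a₁} {a₂} {b₁} {b₂} {a} {b} h₁ h₂ h = +-cancelʳ-≤ (b₁ + b₂) _ _ (begin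
    c * (x₁ + x₂ + e) + b + (b₁ + b₂)                  ≡⟨ regroup c x₁ x₂ e b b₁ b₂ ⟩
    (c * x₁ + b₁) + (c * x₂ + b₂) + c * e + b          ≤⟨ +-monoˡ-≤ b (+-monoˡ-≤ (c * e) (+-mono-≤ h₁ h₂)) ⟩
    a₁ + a₂ + c * e + b                                ≤⟨ h ⟩
    a + (b₁ + b₂)                                      ∎)
    where
    open ≤-Reasoning
    regroup : ∀ c x₁ x₂ e b b₁ b₂ → c * (x₁ + x₂ + e) + b + (b₁ + b₂) ≡ (c * x₁ + b₁) + (c * x₂ + b₂) + c * e + b
    regroup = solve-∀

  P-bound₀ℕ : ∀ k d → 4 * P (k + d) k + rhs₀⁻ k d ≤ rhs₀⁺ k d
  P-bound₀ℕ zero    d       = column (m^n>0 2 d)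
    where
    column : ∀ {Z} → 0 < Z → 4 * (Z ∸ 1) + (4 + 4 * Z) ≤ 1 * Z * 8
    column {suc z} _ = ≤-reflexive (edge z)
      where
      edge : ∀ z → 4 * z + (4 + 4 * (1 + z)) ≡ 1 * (1 + z) * 8
      edge = solve-∀
  P-bound₀ℕ (suc k) zero    =
    subst (λ n → 4 * P n (suc k) + rhs₀⁻ (suc k) 0 ≤ rhs₀⁺ (suc k) 0) (sym (+-identityʳ (suc k))) (P-bound₀-diag k)
  P-bound₀ℕ (suc k) (suc d) = begin
    4 * P (suc k + suc d) (suc k) + rhs₀⁻ (suc k) (suc d)  ≡⟨ cong (λ p → 4 * p + rhs₀⁻ (suc k) (suc d)) (P-split k d) ⟩
    4 * (P₁ + P₂ + e) + rhs₀⁻ (suc k) (suc d)              ≤⟨ scaled-sum-bound {4} {P₁} {P₂} {e} (P-bound₀ℕ (suc k) d) (P-bound₀ℕ k (suc d)) (rhs₀-gap k d) ⟩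
    rhs₀⁺ (suc k) (suc d)                                  ∎
    where
    open ≤-Reasoning
    P₁ = P (suc k + d) (suc k)
    P₂ = P (k + suc d) k
    e = suc k * 2 ^ k + 2 ^ k * 2 ^ suc d

-- The right-hand side over any raw ring with rational constants κ: at ℚ this is RHS itself, at
-- ring-solver syntax it lets the solver verify identities between instances of Ψ.
module BoundPolynomial (R : RawRing 0ℓ 0ℓ) (κ : ℚ → RawRing.Carrier R) where
  open RawRing R
  open import Data.Integer using (+_)
  open import Data.Rational using (_/_; ½)

  infixl 6 _⊖_
  _⊖_ : Carrier → Carrier → Carrier
  x ⊖ y = x + - y

  -- Q, K, K₁, M, X, Z, T stand for 2^n/4, k, k + 1, m, 2^k, 2^(n ∸ k), (3/2)^m.
  rhs : (Q K K₁ M X Z T : Carrier) → Carrier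
  rhs Q K K₁ M X Z T =
    Q * ((K ⊖ M * κ ½) * (K ⊖ M * κ ½) + K + κ ((+ 7) / 4) * M + κ (ℕ→ℚ 8))
      + X * T * (K * κ ½ ⊖ M * κ ((+ 1) / 6)) ⊖ X * K₁ ⊖ Z * T

  Ψ : (K M X Z T : Carrier) → Carrier
  Ψ K M X Z T = rhs (X * Z * κ ((+ 1) / 4)) K (K + 1#) M X Z T

module RationalBound where
  open Recurrence using (P-split)
  open BaseCase using (P-bound₀ℕ; rhs₀⁺; rhs₀⁻)
  open import Data.Nat as ℕ using (ℕ; zero; suc)
  import Data.Nat.Properties as ℕ
  open import Data.Nat.Coprimality using (1-coprimeTo) renaming (sym to coprime-sym)
  open import Data.Integer as ℤ using (+_)
  import Data.Integer.Properties as ℤ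
  open import Data.Rational using (mkℚ; _/_; 0ℚ; 1ℚ; _+_; _*_; -_; _-_; *≤*; +-*-rawRing)
  open import Data.Rational.Properties using (normalize-coprime; +-mono-≤; +-monoˡ-≤; *-monoʳ-≤-nonNeg; module ≤-Reasoning)
  open import Data.Rational.Solver using (module +-*-Solver)
  open import Relation.Binary.PropositionalEquality
    using (_≡_; refl; sym; trans; cong; cong₂; subst; subst₂; module ≡-Reasoning)

  ℕ→ℚ≡mkℚ : ∀ n → ℕ→ℚ n ≡ mkℚ (+ n) 0 (coprime-sym (1-coprimeTo n))
  ℕ→ℚ≡mkℚ n = normalize-coprime (coprime-sym (1-coprimeTo n))

  ℕ→ℚ-homo-+ : ∀ m n → ℕ→ℚ (m ℕ.+ n) ≡ ℕ→ℚ m + ℕ→ℚ n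
  ℕ→ℚ-homo-+ m n = trans (cong (_/ 1) (sym (cong₂ ℤ._+_ (ℤ.*-identityʳ (+ m)) (ℤ.*-identityʳ (+ n)))))
                          (sym (cong₂ _+_ (ℕ→ℚ≡mkℚ m) (ℕ→ℚ≡mkℚ n)))

  ℕ→ℚ-homo-* : ∀ m n → ℕ→ℚ (m ℕ.* n) ≡ ℕ→ℚ m * ℕ→ℚ n
  ℕ→ℚ-homo-* m n = trans (cong (_/ 1) (ℤ.pos-* m n)) (sym (cong₂ _*_ (ℕ→ℚ≡mkℚ m) (ℕ→ℚ≡mkℚ n)))

  ℕ→ℚ-mono-≤ : ∀ {m n} → m ≤ n → ℕ→ℚ m ≤ℚ ℕ→ℚ n
  ℕ→ℚ-mono-≤ {m} {n} m≤n = subst₂ _≤ℚ_ (sym (ℕ→ℚ≡mkℚ m)) (sym (ℕ→ℚ≡mkℚ n))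
    (*≤* (ℤ.*-monoʳ-≤-nonNeg (+ 1) (ℤ.+≤+ m≤n)))

  ¼ : ℚ
  ¼ = (+ 1) / 4

  +n/4≡n*¼ : ∀ n → (+ n) / 4 ≡ ℕ→ℚ n * ¼
  +n/4≡n*¼ n = trans (cong (_/ 4) (trans (cong +_ (sym (ℕ.*-identityʳ n))) (ℤ.pos-* n 1)))
                     (sym (cong (_* ¼) (ℕ→ℚ≡mkℚ n)))

  open BoundPolynomial +-*-rawRing (λ q → q)

  t : ℚ
  t = (+ 3) / 2

  RHS-expand : ∀ k d m → RHS (k ℕ.+ d) k m ≡ Ψ (ℕ→ℚ k) (ℕ→ℚ m) (ℕ→ℚ (2 ℕ.^ k)) (ℕ→ℚ (2 ℕ.^ d)) (t ^ℚ m)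
  RHS-expand k d m = begin
    RHS (k ℕ.+ d) k m
      ≡⟨ cong (λ e → rhs Q K (ℕ→ℚ (k ℕ.+ 1)) M X (ℕ→ℚ (2 ℕ.^ e)) T) (ℕ.m+n∸m≡n k d) ⟩
    rhs Q K (ℕ→ℚ (k ℕ.+ 1)) M X Z T
      ≡⟨ cong₂ (λ Q′ K₁ → rhs Q′ K K₁ M X Z T) quarter (ℕ→ℚ-homo-+ k 1) ⟩
    Ψ K M X Z T ∎
    where
    open ≡-Reasoning
    Q = (+ (2 ℕ.^ (k ℕ.+ d))) / 4
    K = ℕ→ℚ k
    M = ℕ→ℚ m
    X = ℕ→ℚ (2 ℕ.^ k)
    Z = ℕ→ℚ (2 ℕ.^ d)
    T = t ^ℚ m
    quarter : Q ≡ X * Z * ¼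
    quarter = trans (+n/4≡n*¼ (2 ℕ.^ (k ℕ.+ d)))
      (cong (_* ¼) (trans (cong ℕ→ℚ (ℕ.^-distribˡ-+-* 2 k d)) (ℕ→ℚ-homo-* (2 ℕ.^ k) (2 ℕ.^ d))))

  module Syntax (n : ℕ) where
    open +-*-Solver
    polynomials : RawRing 0ℓ 0ℓ
    polynomials = record
      { Carrier = Polynomial n ; _≈_ = _≡_ ; _+_ = _:+_ ; _*_ = _:*_ ; -_ = :-_ ; 0# = con 0ℚ ; 1# = con 1ℚ }
    open BoundPolynomial polynomials con public renaming (Ψ to Ψ′)

  -- The primed atoms are passed with their defining equations so that the solver sees variables.
  Ψ-step : ∀ {K K′ M M′ X X′ Z Z′} T → K′ ≡ 1ℚ + K → M′ ≡ 1ℚ + M → X′ ≡ ℕ→ℚ 2 * X → Z′ ≡ ℕ→ℚ 2 * Z →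
    Ψ K′ M X′ Z T + Ψ K M X Z′ T + (K′ * X + X * Z′) ≡ Ψ K′ M′ X′ Z′ (t * T)
  Ψ-step {K} {M = M} {X = X} {Z = Z} T refl refl refl refl = identity K M X Z T
    where
    identity : ∀ K M X Z T →
      Ψ (1ℚ + K) M (ℕ→ℚ 2 * X) Z T + Ψ K M X (ℕ→ℚ 2 * Z) T + ((1ℚ + K) * X + X * (ℕ→ℚ 2 * Z))
        ≡ Ψ (1ℚ + K) (1ℚ + M) (ℕ→ℚ 2 * X) (ℕ→ℚ 2 * Z) (t * T)
    identity = solve 5 (λ K M X Z T →
        Ψ′ (con 1ℚ :+ K) M (two :* X) Z T :+ Ψ′ K M X (two :* Z) T :+ ((con 1ℚ :+ K) :* X :+ X :* (two :* Z))
      := Ψ′ (con 1ℚ :+ K) (con 1ℚ :+ M) (two :* X) (two :* Z) (con t :* T)) refl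
      where
      open +-*-Solver
      open Syntax 5
      two = con (ℕ→ℚ 2)

  Ψ-base : ∀ K X Z → Ψ K 0ℚ X Z 1ℚ ≡ (X * Z * (K * K + K + ℕ→ℚ 8) - (ℕ→ℚ 2 * (K + ℕ→ℚ 2) * X + ℕ→ℚ 4 * Z)) * ¼
  Ψ-base = solve 3 (λ K X Z →
      Ψ′ K (con 0ℚ) X Z (con 1ℚ)
    := (X :* Z :* (K :* K :+ K :+ con (ℕ→ℚ 8)) :- (con (ℕ→ℚ 2) :* (K :+ con (ℕ→ℚ 2)) :* X :+ con (ℕ→ℚ 4) :* Z)) :* con ¼) refl
    where
    open +-*-Solver
    open Syntax 3

  ℕ→ℚ-quarter-bound : ∀ {p a b} → 4 ℕ.* p ℕ.+ b ≤ a → ℕ→ℚ p ≤ℚ (ℕ→ℚ a - ℕ→ℚ b) * ¼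
  ℕ→ℚ-quarter-bound {p} {a} {b} 4p+b≤a = begin
    ℕ→ℚ p                                         ≡⟨ unscale (ℕ→ℚ p) (ℕ→ℚ b) ⟩
    (ℕ→ℚ 4 * ℕ→ℚ p + ℕ→ℚ b - ℕ→ℚ b) * ¼            ≤⟨ *-monoʳ-≤-nonNeg ¼ (+-monoˡ-≤ (- ℕ→ℚ b) scaled) ⟩
    (ℕ→ℚ a - ℕ→ℚ b) * ¼                           ∎
    where
    open ≤-Reasoning
    scaled : ℕ→ℚ 4 * ℕ→ℚ p + ℕ→ℚ b ≤ℚ ℕ→ℚ a
    scaled = subst (_≤ℚ ℕ→ℚ a) (trans (ℕ→ℚ-homo-+ (4 ℕ.* p) b) (cong (_+ ℕ→ℚ b) (ℕ→ℚ-homo-* 4 p))) (ℕ→ℚ-mono-≤ 4p+b≤a)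
    unscale : ∀ p b → p ≡ (ℕ→ℚ 4 * p + b - b) * ¼
    unscale = solve 2 (λ p b → p := (con (ℕ→ℚ 4) :* p :+ b :- b) :* con ¼) refl
      where open +-*-Solver

  P-bound₀ : ∀ k d → ℕ→ℚ (P (k ℕ.+ d) k) ≤ℚ RHS (k ℕ.+ d) k 0
  P-bound₀ k d = begin
    ℕ→ℚ (P (k ℕ.+ d) k)
      ≤⟨ ℕ→ℚ-quarter-bound {P (k ℕ.+ d) k} {rhs₀⁺ k d} {rhs₀⁻ k d} (P-bound₀ℕ k d) ⟩
    (ℕ→ℚ (rhs₀⁺ k d) - ℕ→ℚ (rhs₀⁻ k d)) * ¼
      ≡⟨ cong₂ (λ a b → (a - b) * ¼) ℕ→ℚ-rhs₀⁺ ℕ→ℚ-rhs₀⁻ ⟩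
    (X * Z * (K * K + K + ℕ→ℚ 8) - (ℕ→ℚ 2 * (K + ℕ→ℚ 2) * X + ℕ→ℚ 4 * Z)) * ¼
      ≡⟨ Ψ-base K X Z ⟨
    Ψ K 0ℚ X Z 1ℚ
      ≡⟨ RHS-expand k d 0 ⟨
    RHS (k ℕ.+ d) k 0
      ∎
    where
    open ≤-Reasoning
    K = ℕ→ℚ k
    X = ℕ→ℚ (2 ℕ.^ k)
    Z = ℕ→ℚ (2 ℕ.^ d)
    ℕ→ℚ-rhs₀⁺ : ℕ→ℚ (rhs₀⁺ k d) ≡ X * Z * (K * K + K + ℕ→ℚ 8)
    ℕ→ℚ-rhs₀⁺ = trans (ℕ→ℚ-homo-* (2 ℕ.^ k ℕ.* 2 ℕ.^ d) _) (cong₂ _*_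
      (ℕ→ℚ-homo-* (2 ℕ.^ k) (2 ℕ.^ d))
      (trans (ℕ→ℚ-homo-+ (k ℕ.* k ℕ.+ k) 8)
             (cong (_+ ℕ→ℚ 8) (trans (ℕ→ℚ-homo-+ (k ℕ.* k) k) (cong (_+ K) (ℕ→ℚ-homo-* k k))))))
    ℕ→ℚ-rhs₀⁻ : ℕ→ℚ (rhs₀⁻ k d) ≡ ℕ→ℚ 2 * (K + ℕ→ℚ 2) * X + ℕ→ℚ 4 * Z
    ℕ→ℚ-rhs₀⁻ = trans (ℕ→ℚ-homo-+ (2 ℕ.* (k ℕ.+ 2) ℕ.* 2 ℕ.^ k) (4 ℕ.* 2 ℕ.^ d)) (cong₂ _+_
      (trans (ℕ→ℚ-homo-* (2 ℕ.* (k ℕ.+ 2)) (2 ℕ.^ k))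
             (cong (_* X) (trans (ℕ→ℚ-homo-* 2 (k ℕ.+ 2)) (cong (ℕ→ℚ 2 *_) (ℕ→ℚ-homo-+ k 2)))))
      (ℕ→ℚ-homo-* 4 (2 ℕ.^ d)))

  RHS-step : ∀ k d m →
    RHS (suc k ℕ.+ d) (suc k) m + RHS (k ℕ.+ suc d) k m + ℕ→ℚ (suc k ℕ.* 2 ℕ.^ k ℕ.+ 2 ℕ.^ k ℕ.* 2 ℕ.^ suc d)
      ≡ RHS (suc k ℕ.+ suc d) (suc k) (suc m)
  RHS-step k d m = begin
    RHS (suc k ℕ.+ d) (suc k) m + RHS (k ℕ.+ suc d) k m + ℕ→ℚ (suc k ℕ.* 2 ℕ.^ k ℕ.+ 2 ℕ.^ k ℕ.* 2 ℕ.^ suc d)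
      ≡⟨ cong₂ _+_ (cong₂ _+_ (RHS-expand (suc k) d m) (RHS-expand k (suc d) m)) ℕ→ℚ-extra ⟩
    Ψ K′ M X′ Z T + Ψ K M X Z′ T + (K′ * X + X * Z′)
      ≡⟨ Ψ-step {K} {M = M} {X = X} {Z = Z} T
           (ℕ→ℚ-homo-+ 1 k) (ℕ→ℚ-homo-+ 1 m) (ℕ→ℚ-homo-* 2 (2 ℕ.^ k)) (ℕ→ℚ-homo-* 2 (2 ℕ.^ d)) ⟩
    Ψ K′ (ℕ→ℚ (suc m)) X′ Z′ (t * T)
      ≡⟨ RHS-expand (suc k) (suc d) (suc m) ⟨
    RHS (suc k ℕ.+ suc d) (suc k) (suc m) ∎
    where
    open ≡-Reasoning
    K = ℕ→ℚ k
    K′ = ℕ→ℚ (suc k)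
    M = ℕ→ℚ m
    X = ℕ→ℚ (2 ℕ.^ k)
    X′ = ℕ→ℚ (2 ℕ.^ suc k)
    Z = ℕ→ℚ (2 ℕ.^ d)
    Z′ = ℕ→ℚ (2 ℕ.^ suc d)
    T = t ^ℚ m
    ℕ→ℚ-extra : ℕ→ℚ (suc k ℕ.* 2 ℕ.^ k ℕ.+ 2 ℕ.^ k ℕ.* 2 ℕ.^ suc d) ≡ K′ * X + X * Z′
    ℕ→ℚ-extra = trans (ℕ→ℚ-homo-+ (suc k ℕ.* 2 ℕ.^ k) (2 ℕ.^ k ℕ.* 2 ℕ.^ suc d))
      (cong₂ _+_ (ℕ→ℚ-homo-* (suc k) (2 ℕ.^ k)) (ℕ→ℚ-homo-* (2 ℕ.^ k) (2 ℕ.^ suc d)))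

  P-bound : ∀ m {k d} → m ≤ k → m ≤ d → ℕ→ℚ (P (k ℕ.+ d) k) ≤ℚ RHS (k ℕ.+ d) k m
  P-bound zero    {k}     {d}     _           _           = P-bound₀ k d
  P-bound (suc m) {suc k} {suc d} (ℕ.s≤s m≤k) (ℕ.s≤s m≤d) = begin
    ℕ→ℚ (P (suc k ℕ.+ suc d) (suc k))
      ≡⟨ cong ℕ→ℚ (P-split k d) ⟩
    ℕ→ℚ (P₁ ℕ.+ P₂ ℕ.+ e)
      ≡⟨ trans (ℕ→ℚ-homo-+ (P₁ ℕ.+ P₂) e) (cong (_+ ℕ→ℚ e) (ℕ→ℚ-homo-+ P₁ P₂)) ⟩
    ℕ→ℚ P₁ + ℕ→ℚ P₂ + ℕ→ℚ e
      ≤⟨ +-monoˡ-≤ (ℕ→ℚ e) (+-mono-≤ (P-bound m (ℕ.m≤n⇒m≤1+n m≤k) m≤d) (P-bound m m≤k (ℕ.m≤n⇒m≤1+n m≤d))) ⟩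
    RHS (suc k ℕ.+ d) (suc k) m + RHS (k ℕ.+ suc d) k m + ℕ→ℚ e
      ≡⟨ RHS-step k d m ⟩
    RHS (suc k ℕ.+ suc d) (suc k) (suc m)
      ∎
    where
    open ≤-Reasoning
    P₁ = P (suc k ℕ.+ d) (suc k)
    P₂ = P (k ℕ.+ suc d) k
    e = suc k ℕ.* 2 ℕ.^ k ℕ.+ 2 ℕ.^ k ℕ.* 2 ℕ.^ suc d

open Recurrence using (P3≡P)
open RationalBound using (P-bound)
open import Data.Nat using (_+_)
open import Data.Nat.Properties using (m≤n⊓o⇒m≤n; m≤n⊓o⇒m≤o; +-monoʳ-≤; m+[n∸m]≡n)
open import Relation.Binary.PropositionalEquality using (cong; sym; subst)

lemma10 : ∀ (n k m : ℕ) → k ≤ n → m ≤ k ⊓ (n ∸ k) →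
    ℕ→ℚ (P3 n k m) ≤ℚ RHS n k m
lemma10 n k m k≤n m≤k⊓d = subst (λ n′ → ℕ→ℚ (P3 n′ k m) ≤ℚ RHS n′ k m) (m+[n∸m]≡n k≤n) bound
  where
  m≤k = m≤n⊓o⇒m≤n k (n ∸ k) m≤k⊓d
  m≤d = m≤n⊓o⇒m≤o k (n ∸ k) m≤k⊓d
  bound : ℕ→ℚ (P3 (k + (n ∸ k)) k m) ≤ℚ RHS (k + (n ∸ k)) k m
  bound = subst (_≤ℚ RHS (k + (n ∸ k)) k m) (cong ℕ→ℚ (sym (P3≡P m m≤k (+-monoʳ-≤ k m≤d))))
                (P-bound m m≤k m≤d)
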